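{- Let $\Pi = (\mathcal{A}, \mathcal{E}, \mathcal{R})$ be an ELP and let $\Pi' = (\mathcal{A}, \mathcal{E}', \mathcal{R})$ be an ELP with the same set of rules and the same set of atoms, but with $\mathcal{E}' \supset \mathcal{E}$ and $\mathcal{E}' \setminus \mathcal{E} = \{ \mathbf{not}\, \ell \}$ for a single epistemic literal $\mathbf{not}\,\ell$ over $\mathcal{A}$. Then $\mathrm{CWV}(\Pi) = \mathrm{CWV}(\Pi')$.
   Context: Literals over a set of atoms $\mathcal{A}$ are atoms $a\in\mathcal{A}$ or their default negations $\neg a$. An interpretation is a set $I\subseteq\mathcal{A}$; $I\models a$ iff $a\in I$, and $I\models\neg\varphi$ iff $I\not\models\varphi$. A (ground) logic program is a pair $(\mathcal{A},\mathcal{R})$ of a set of atoms and a set of rules $a_1\vee\cdots\vee a_l\leftarrow a_{l+1},\ldots,a_m,\neg\ell_1,\ldots,\neg\ell_n$ ($a_i\in\mathcal{A}$, $\ell_i$ literals); head $\{a_1,\dots,a_l\}$, positive body $\{a_{l+1},\dots,a_m\}$. $I$ is a model of a rule if, whenever $I$ satisfies all body elements, $I$ contains some head atom. The GL-reduct $\Pi^I$ consists of the rules $\mathrm{head}(r)\leftarrow\mathrm{pbody}(r)$ for all rules $r$ such that $I\models\neg\ell$ for every $\neg\ell$ in the body of $r$. $M\subseteq\mathcal{A}$ is an answer set of $\Pi$ if $M$ is a model of $\Pi$ and no $M'\subsetneq M$ is a model of $\Pi^M$; $\mathrm{AS}(\Pi)$ is the set of answer sets. An epistemic literal is $\mathbf{not}\,\ell$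 with $\ell$ a literal. An ELP is a triple $(\mathcal{A},\mathcal{E},\mathcal{R})$, $\mathcal{E}$ a set of epistemic literals over $\mathcal{A}$, $\mathcal{R}$ a set of rules $a_1\vee\cdots\vee a_k\leftarrow\ell_1,\ldots,\ell_m,\xi_1,\ldots,\xi_j,\neg\xi_{j+1},\ldots,\neg\xi_n$ with $a_i\in\mathcal{A}$, $\ell_i$ literals, $\xi_i\in\mathcal{E}$. A guess is $\Phi\subseteq\mathcal{E}$. A set $\mathcal{I}$ of interpretations is $\Phi$-compatible w.r.t. $\mathcal{E}$ iff $\mathcal{I}\neq\emptyset$, for each $\mathbf{not}\,\ell\in\Phi$ some $I\in\mathcal{I}$ has $I\not\models\ell$, and for each $\mathbf{not}\,\ell\in\mathcal{E}\setminus\Phi$ all $I\in\mathcal{I}$ satisfy $\ell$. The epistemic reduct $\Pi^\Phi$ is the logic program obtained by replacing each $\mathbf{not}\,\ell\in\Phi$ by $\top$ and every remaining $\mathbf{not}$ by $\neg$ ($\neg\neg\neg a$ treated as $\neg a$). $\mathcal{M}$ is a candidate world view (CWV) of $\Pi$ if for some guess $\Phi$, $\mathcal{M}=\mathrm{AS}(\Pi^\Phi)$ and $\mathcal{M}$ is $\Phi$-compatible w.r.t. $\mathcal{E}$; $\mathrm{CWV}(\Pi)$ is the set of CWVs. -}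

module Defs where

open import Data.Nat using (ℕ)
open import Data.Fin using (Fin) renaming (_≟_ to _≟ᶠ_)
open import Data.Fin.Subset using (Subset; _∈_; _⊂_)
open import Data.Fin.Subset.Properties using (_∈?_)
open import Data.List using (List; []; _∷_; _++_; map; filter)
open import Data.List.Relation.Unary.All as All using (All)
open import Data.List.Relation.Unary.Any using (Any)
open import Data.List.Membership.Propositional renaming (_∈_ to _∈ₗ_)
open import Data.Maybe using (Maybe; just; nothing)
open import Data.Product using (_×_; _,_; ∃-syntax)
open import Data.Bool using (true; false)
open import Relation.Nullary using (¬_; Dec; yes; no)
open import Relation.Nullary.Decidable using (map′; ¬?)
open import Relation.Binary.PropositionalEquality using (_≡_; refl; cong)
open import Relation.Binary.Definitions using (DecidableEquality)
open import Data.List.Membership.DecPropositional as DM using ()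

Interp : ℕ → Set
Interp n = Subset n

data Lit (n : ℕ) : Set where
  atom : Fin n → Lit n
  naf  : Fin n → Lit n

_⊨_ : ∀ {n} → Interp n → Lit n → Set
I ⊨ atom a = a ∈ I
I ⊨ naf a  = ¬ (a ∈ I)

_⊨?_ : ∀ {n} (I : Interp n) (ℓ : Lit n) → Dec (I ⊨ ℓ)
I ⊨? atom a = a ∈? I
I ⊨? naf a  = ¬? (a ∈? I)

atom-inj : ∀ {n} {a b : Fin n} → atom a ≡ atom b → a ≡ b
atom-inj refl = refl

naf-inj : ∀ {n} {a b : Fin n} → naf a ≡ naf b → a ≡ b
naf-inj refl = refl

_≟ₗ_ : ∀ {n} → DecidableEquality (Lit n)
atom a ≟ₗ atom b = map′ (cong atom) atom-inj (a ≟ᶠ b)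
atom a ≟ₗ naf b  = no (λ ())
naf a  ≟ₗ atom b = no (λ ())
naf a  ≟ₗ naf b  = map′ (cong naf) naf-inj (a ≟ᶠ b)

-- Logic programs.
-- A rule  a₁ ∨ … ∨ aₗ ← b₁,…,bₖ, ¬ℓ₁,…,¬ℓₘ  is stored as
-- head = [a₁…aₗ], pbody = [b₁…bₖ], nbody = [ℓ₁…ℓₘ] (the literals under ¬).

record LPRule (n : ℕ) : Set where
  constructor lprule
  field
    head  : List (Fin n)
    pbody : List (Fin n)
    nbody : List (Lit n)
open LPRule public

LP : ℕ → Set
LP n = List (LPRule n)

BodySat : ∀ {n} → Interp n → LPRule n → Set
BodySat I r = All (_∈ I) (pbody r) × All (λ ℓ → ¬ (I ⊨ ℓ)) (nbody r)

ModelRule : ∀ {n} → Interp n → LPRule n → Set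
ModelRule I r = BodySat I r → Any (_∈ I) (head r)

Model : ∀ {n} → Interp n → LP n → Set
Model I P = All (ModelRule I) P

NegSat : ∀ {n} → Interp n → LPRule n → Set
NegSat I r = All (λ ℓ → ¬ (I ⊨ ℓ)) (nbody r)

NegSat? : ∀ {n} (I : Interp n) (r : LPRule n) → Dec (NegSat I r)
NegSat? I r = All.all? (λ ℓ → ¬? (I ⊨? ℓ)) (nbody r)

GLReduct : ∀ {n} → LP n → Interp n → LP n
GLReduct P I = map (λ r → lprule (head r) (pbody r) []) (filter (NegSat? I) P)

AnswerSet : ∀ {n} → LP n → Interp n → Set
AnswerSet P M = Model M P × (∀ M′ → M′ ⊂ M → ¬ Model M′ (GLReduct P M))

data ELit (n : ℕ) : Set where
  not : Lit n → ELit n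

not-inj : ∀ {n} {a b : Lit n} → not a ≡ not b → a ≡ b
not-inj refl = refl

_≟ₑ_ : ∀ {n} → DecidableEquality (ELit n)
not a ≟ₑ not b = map′ (cong not) not-inj (a ≟ₗ b)

-- A rule  a₁ ∨ … ∨ aₖ ← ℓ₁,…,ℓₘ, ξ₁,…,ξⱼ, ¬ξⱼ₊₁,…,¬ξₙ
record ERule (n : ℕ) : Set where
  constructor erule
  field
    ehead : List (Fin n)
    ebody : List (Lit n)
    epos  : List (ELit n)
    eneg  : List (ELit n)    -- ξⱼ₊₁,…,ξₙ  (occurring as ¬ξ)
open ERule public

-- An ELP (𝒜, ℰ, ℛ) with 𝒜 = Fin n; ℰ is a finite set given as a list;
-- every epistemic literal used in a rule must belong to ℰ.
record ELP (n : ℕ) : Set where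
  constructor elp
  field
    E     : List (ELit n)
    rules : List (ERule n)
    wf    : All (λ r → All (_∈ₗ E) (epos r) × All (_∈ₗ E) (eneg r)) rules
open ELP public

-- ¬¬ℓ written as ¬ζ :  ¬¬a = ¬(¬a),  ¬¬¬a = ¬a
dneg : ∀ {n} → Lit n → Lit n
dneg (atom a) = naf a
dneg (naf a)  = atom a

posAtoms : ∀ {n} → List (Lit n) → List (Fin n)
posAtoms [] = []
posAtoms (atom a ∷ ls) = a ∷ posAtoms ls
posAtoms (naf a ∷ ls)  = posAtoms ls

negAtoms : ∀ {n} → List (Lit n) → List (Lit n)
negAtoms [] = []
negAtoms (atom a ∷ ls) = negAtoms ls
negAtoms (naf a ∷ ls)  = atom a ∷ negAtoms ls

-- ξ = not ℓ ∉ Φ in positive position becomes ¬ℓ; ξ ∈ Φ becomes ⊤ (dropped)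
posE : ∀ {n} → List (ELit n) → List (ELit n) → List (Lit n)
posE Φ [] = []
posE Φ (not ℓ ∷ ξs) with DM._∈?_ _≟ₑ_ (not ℓ) Φ
... | yes _ = posE Φ ξs
... | no  _ = ℓ ∷ posE Φ ξs

-- ¬ξ with ξ = not ℓ ∉ Φ becomes ¬¬ℓ
negE : ∀ {n} → List (ELit n) → List (ELit n) → List (Lit n)
negE Φ [] = []
negE Φ (not ℓ ∷ ξs) with DM._∈?_ _≟ₑ_ (not ℓ) Φ
... | yes _ = negE Φ ξs
... | no  _ = dneg ℓ ∷ negE Φ ξs

-- does some ¬ξ with ξ ∈ Φ occur (then the body contains ¬⊤, i.e. is false)?
AnyNegGuessed? : ∀ {n} (Φ : List (ELit n)) (ξs : List (ELit n)) →
                 Dec (Any (_∈ₗ Φ) ξs)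
AnyNegGuessed? Φ ξs = Data.List.Relation.Unary.Any.any? (λ ξ → DM._∈?_ _≟ₑ_ ξ Φ) ξs
  where import Data.List.Relation.Unary.Any

-- reduct of one rule; a rule whose body contains ¬⊤ is removed
-- (its body can never be satisfied, so this does not change models,
-- GL-reducts or answer sets).
reductRule : ∀ {n} → List (ELit n) → ERule n → List (LPRule n)
reductRule Φ r with AnyNegGuessed? Φ (eneg r)
... | yes _ = []
... | no  _ = lprule (ehead r) (posAtoms (ebody r))
                     (negAtoms (ebody r) ++ posE Φ (epos r) ++ negE Φ (eneg r)) ∷ []

EReduct : ∀ {n} → ELP n → List (ELit n) → LP n
EReduct Π Φ = Data.List.concatMap (reductRule Φ) (rules Π)
  where import Data.List

Compatible : ∀ {n} → List (ELit n) → List (ELit n) → (Interp n → Set) → Set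
Compatible ℰ Φ 𝓜 =
  (∃[ I ] 𝓜 I)
  × (∀ ℓ → not ℓ ∈ₗ Φ → ∃[ I ] (𝓜 I × ¬ (I ⊨ ℓ)))
  × (∀ ℓ → not ℓ ∈ₗ ℰ → ¬ (not ℓ ∈ₗ Φ) → ∀ I → 𝓜 I → I ⊨ ℓ)

IsAS : ∀ {n} → LP n → (Interp n → Set) → Set
IsAS P 𝓜 = ∀ I → (𝓜 I → AnswerSet P I) × (AnswerSet P I → 𝓜 I)

IsCWV : ∀ {n} → ELP n → (Interp n → Set) → Set
IsCWV Π 𝓜 = ∃[ Φ ] (All (_∈ₗ E Π) Φ × IsAS (EReduct Π Φ) 𝓜 × Compatible (E Π) Φ 𝓜)

-- Call a guess Φ correct for 𝓜 on ℰ if, for each ξ ∈ ℰ, ξ ∈ Φ exactly when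
-- some I ∈ 𝓜 falsifies the literal under ξ. For Φ ⊆ ℰ, 𝓜 is Φ-compatible iff
-- 𝓜 is non-empty and Φ is correct for it, so the guess behind a candidate world
-- view is determined by the world view itself. The epistemic reduct only looks at the
-- guess on the epistemic literals occurring in the rules, which lie in both ℰ
-- and ℰ′; there the correct guesses for ℰ and for ℰ′ agree, so both programs
-- yield the same reduct. Deciding whether a world view falsifies a literal is
-- possible because answer sets over finitely many atoms are decidable.
module Submission where

open import Defs
open import Data.Nat using (ℕ)
open import Data.List.Membership.Propositional using (_∈_; _∉_)
open import Data.Product using (_×_; _,_; proj₁; proj₂; ∃-syntax; uncurry)
open import Data.List using (List; []; _∷_; _++_; concatMap; filter)
open import Data.List.Relation.Unary.All as All using (All; []; _∷_)
open import Data.List.Relation.Unary.Any as Any using (Any; here; there)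
import Data.List.Membership.DecPropositional as DecMembership
open import Data.List.Membership.Propositional.Properties using (∈-filter⁻; ∈-filter⁺)
open import Data.List.Relation.Binary.Subset.Propositional.Properties using (filter-⊆)
open import Data.Fin.Subset.Properties using (_∈?_; _⊂?_; anySubset?)
open import Function.Bundles using (_⇔_; mk⇔; Equivalence)
import Function.Properties.Equivalence as ⇔
open import Relation.Binary.PropositionalEquality using (_≡_; refl; sym; cong; cong₂; subst)
open import Relation.Nullary using (¬_; Dec; yes; no; contradiction)
open import Relation.Nullary.Decidable using (¬?; _×-dec_; _→-dec_; map′; decidable-stable)
open import Relation.Unary using (Decidable)

open Equivalence using (to; from)

private
  variable
    n : ℕ
    Φ Φ′ ℰ : List (ELit n)
    𝓜 : Interp n → Set

_∈ₑ?_ : (ξ : ELit n) (Φ : List (ELit n)) → Dec (ξ ∈ Φ)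
_∈ₑ?_ = DecMembership._∈?_ _≟ₑ_

bodySat? : (I : Interp n) (r : LPRule n) → Dec (BodySat I r)
bodySat? I r = All.all? (_∈? I) (pbody r) ×-dec All.all? (λ ℓ → ¬? (I ⊨? ℓ)) (nbody r)

model? : (I : Interp n) (P : LP n) → Dec (Model I P)
model? I = All.all? λ r → bodySat? I r →-dec Any.any? (_∈? I) (head r)

answerSet? : (P : LP n) (M : Interp n) → Dec (AnswerSet P M)
answerSet? P M = model? M P ×-dec map′
  (λ ¬smaller M′ M′⊂M M′⊨P → ¬smaller (M′ , M′⊂M , M′⊨P))
  (λ minimal (M′ , M′⊂M , M′⊨P) → minimal M′ M′⊂M M′⊨P)
  (¬? (anySubset? λ M′ → (M′ ⊂? M) ×-dec model? M′ (GLReduct P M)))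

SameOn : List (ELit n) → List (ELit n) → ELit n → Set
SameOn Φ Φ′ ξ = ξ ∈ Φ ⇔ ξ ∈ Φ′

posE-cong : ∀ ξs → All (SameOn Φ Φ′) ξs → posE Φ ξs ≡ posE Φ′ ξs
posE-cong [] [] = refl
posE-cong {Φ = Φ} {Φ′} (not ℓ ∷ ξs) (same ∷ sames) with not ℓ ∈ₑ? Φ | not ℓ ∈ₑ? Φ′
... | yes _  | yes _  = posE-cong ξs sames
... | no _   | no _   = cong (ℓ ∷_) (posE-cong ξs sames)
... | yes ∈Φ | no ∉Φ′ = contradiction (to same ∈Φ) ∉Φ′
... | no ∉Φ  | yes ∈Φ′ = contradiction (from same ∈Φ′) ∉Φ

negE-cong : ∀ ξs → All (SameOn Φ Φ′) ξs → negE Φ ξs ≡ negE Φ′ ξs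
negE-cong [] [] = refl
negE-cong {Φ = Φ} {Φ′} (not ℓ ∷ ξs) (same ∷ sames) with not ℓ ∈ₑ? Φ | not ℓ ∈ₑ? Φ′
... | yes _  | yes _  = negE-cong ξs sames
... | no _   | no _   = cong (dneg ℓ ∷_) (negE-cong ξs sames)
... | yes ∈Φ | no ∉Φ′ = contradiction (to same ∈Φ) ∉Φ′
... | no ∉Φ  | yes ∈Φ′ = contradiction (from same ∈Φ′) ∉Φ

any-∈-cong : ∀ {ξs} → All (SameOn Φ Φ′) ξs → Any (_∈ Φ) ξs → Any (_∈ Φ′) ξs
any-∈-cong (same ∷ _)  (here ∈Φ)  = here (to same ∈Φ)
any-∈-cong (_ ∷ sames) (there ∈Φ) = there (any-∈-cong sames ∈Φ)

reductRule-cong : ∀ r → All (SameOn Φ Φ′) (epos r) → All (SameOn Φ Φ′) (eneg r) →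
                  reductRule Φ r ≡ reductRule Φ′ r
reductRule-cong {Φ = Φ} {Φ′} r samePos sameNeg
  with AnyNegGuessed? Φ (eneg r) | AnyNegGuessed? Φ′ (eneg r)
... | yes _ | yes _ = refl
... | yes guessed | no ¬guessed′ =
  contradiction (any-∈-cong sameNeg guessed) ¬guessed′
... | no ¬guessed | yes guessed′ =
  contradiction (any-∈-cong (All.map ⇔.sym sameNeg) guessed′) ¬guessed
... | no _ | no _ =
  cong (λ body → lprule (ehead r) (posAtoms (ebody r)) (negAtoms (ebody r) ++ body) ∷ [])
       (cong₂ _++_ (posE-cong (epos r) samePos) (negE-cong (eneg r) sameNeg))

UsesOnly : (ELit n → Set) → ERule n → Set
UsesOnly P r = All P (epos r) × All P (eneg r)

concatMap-reductRule-cong : ∀ rs → All (UsesOnly (SameOn Φ Φ′)) rs →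
  concatMap (reductRule Φ) rs ≡ concatMap (reductRule Φ′) rs
concatMap-reductRule-cong [] [] = refl
concatMap-reductRule-cong (r ∷ rs) ((samePos , sameNeg) ∷ sames) =
  cong₂ _++_ (reductRule-cong r samePos sameNeg) (concatMap-reductRule-cong rs sames)

EReduct-cong : (Π Π′ : ELP n) → rules Π ≡ rules Π′ →
  (∀ {ξ} → ξ ∈ E Π → ξ ∈ E Π′ → SameOn Φ Φ′ ξ) →
  EReduct Π Φ ≡ EReduct Π′ Φ′
EReduct-cong {Φ = Φ} {Φ′} Π Π′ sameRules same =
  subst (λ rs → EReduct Π Φ ≡ concatMap (reductRule Φ′) rs) sameRules
    (concatMap-reductRule-cong (rules Π)
      (All.zipWith (λ {r} → sameOnRule {r}) (wf Π , wf′)))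
  where
  wf′ : All (UsesOnly (_∈ E Π′)) (rules Π)
  wf′ = subst (All (UsesOnly (_∈ E Π′))) (sym sameRules) (wf Π′)
  sameOnRule : ∀ {r} → UsesOnly (_∈ E Π) r × UsesOnly (_∈ E Π′) r →
               UsesOnly (SameOn Φ Φ′) r
  sameOnRule ((pos , neg) , (pos′ , neg′)) =
    All.zipWith (uncurry same) (pos , pos′) , All.zipWith (uncurry same) (neg , neg′)

_⊩_ : (Interp n → Set) → ELit n → Set
𝓜 ⊩ not ℓ = ∃[ I ] (𝓜 I × ¬ (I ⊨ ℓ))

⊩? : ∀ {P : LP n} → IsAS P 𝓜 → Decidable (𝓜 ⊩_)
⊩? {P = P} 𝓜≡AS (not ℓ) =
  map′ (λ (I , AS , I⊭ℓ) → I , proj₂ (𝓜≡AS I) AS , I⊭ℓ)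
       (λ (I , I∈𝓜 , I⊭ℓ) → I , proj₁ (𝓜≡AS I) I∈𝓜 , I⊭ℓ)
       (anySubset? λ I → answerSet? P I ×-dec ¬? (I ⊨? ℓ))

CorrectGuess : List (ELit n) → List (ELit n) → (Interp n → Set) → Set
CorrectGuess ℰ Φ 𝓜 = ∀ {ξ} → ξ ∈ ℰ → ξ ∈ Φ ⇔ 𝓜 ⊩ ξ

compatible⇒correctGuess : Compatible ℰ Φ 𝓜 → CorrectGuess ℰ Φ 𝓜
compatible⇒correctGuess {Φ = Φ} (_ , witness , unanimous) {not ℓ} ξ∈ℰ =
  mk⇔ (witness ℓ) λ (I , I∈𝓜 , I⊭ℓ) →
    decidable-stable (not ℓ ∈ₑ? Φ) λ ξ∉Φ → I⊭ℓ (unanimous ℓ ξ∈ℰ ξ∉Φ I I∈𝓜)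

correctGuess⇒compatible : All (_∈ ℰ) Φ → ∃[ I ] 𝓜 I →
                          CorrectGuess ℰ Φ 𝓜 → Compatible ℰ Φ 𝓜
correctGuess⇒compatible Φ⊆ℰ nonEmpty correct =
  nonEmpty ,
  (λ ℓ ξ∈Φ → to (correct (All.lookup Φ⊆ℰ ξ∈Φ)) ξ∈Φ) ,
  (λ ℓ ξ∈ℰ ξ∉Φ I I∈𝓜 → decidable-stable (I ⊨? ℓ) λ I⊭ℓ →
     ξ∉Φ (from (correct ξ∈ℰ) (I , I∈𝓜 , I⊭ℓ)))

filter-correctGuess : (⊩?𝓜 : Decidable (𝓜 ⊩_)) (ℰ : List (ELit n)) →
                      CorrectGuess ℰ (filter ⊩?𝓜 ℰ) 𝓜
filter-correctGuess ⊩?𝓜 ℰ ξ∈ℰ =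
  mk⇔ (λ ξ∈Φ → proj₂ (∈-filter⁻ ⊩?𝓜 {xs = ℰ} ξ∈Φ)) (∈-filter⁺ ⊩?𝓜 ξ∈ℰ)

IsCWV-transfer : (Π Π′ : ELP n) → rules Π ≡ rules Π′ → IsCWV Π 𝓜 → IsCWV Π′ 𝓜
IsCWV-transfer {𝓜 = 𝓜} Π Π′ sameRules (Φ , _ , 𝓜≡AS , compatible@(nonEmpty , _)) =
  guess′ , guess′⊆E′ ,
  subst (λ P → IsAS P 𝓜) (EReduct-cong Π Π′ sameRules sameGuess) 𝓜≡AS ,
  correctGuess⇒compatible guess′⊆E′ nonEmpty correct′
  where
  ⊩?𝓜 : Decidable (𝓜 ⊩_)
  ⊩?𝓜 = ⊩? 𝓜≡AS
  guess′ : List (ELit _)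
  guess′ = filter ⊩?𝓜 (E Π′)
  guess′⊆E′ : All (_∈ E Π′) guess′
  guess′⊆E′ = All.tabulate (filter-⊆ ⊩?𝓜 (E Π′))
  correct′ : CorrectGuess (E Π′) guess′ 𝓜
  correct′ = filter-correctGuess ⊩?𝓜 (E Π′)
  sameGuess : ∀ {ξ} → ξ ∈ E Π → ξ ∈ E Π′ → SameOn Φ guess′ ξ
  sameGuess ξ∈E ξ∈E′ =
    ⇔.trans (compatible⇒correctGuess compatible ξ∈E) (⇔.sym (correct′ ξ∈E′))

proposition3 : ∀ {n} (Π Π′ : ELP n) (ℓ : Lit n) →
    rules Π ≡ rules Π′ →
    (∀ ξ → ξ ∈ E Π → ξ ∈ E Π′) →
    (∀ ξ → (ξ ∈ E Π′ × ξ ∉ E Π) ⇔ (ξ ≡ not ℓ)) →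
    ∀ (𝓜 : Interp n → Set) → IsCWV Π 𝓜 ⇔ IsCWV Π′ 𝓜
proposition3 Π Π′ _ sameRules _ _ _ =
  mk⇔ (IsCWV-transfer Π Π′ sameRules) (IsCWV-transfer Π′ Π (sym sameRules))
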